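{- Let $\mathcal{N}$ be a class of simple matroids, closed under isomorphism, with the property that whenever a simple matroid $M$ has an element $e$ such that $\mathrm{si}(M/e)$ is isomorphic to a member of $\mathcal{N}$, then $M$ has an induced restriction isomorphic to a member of $\mathcal{N}$. Let $\mathcal{N}'$ be the class of induced-minor-minimal members of $\mathcal{N}$. Then a simple matroid has no induced minor isomorphic to a member of $\mathcal{N}'$ if and only if it has no induced restriction isomorphic to a member of $\mathcal{N}$.
   Context: All matroids are finite and simple; every contraction is immediately followed by simplification. An induced restriction of $M$ is $M|F$ for a flat $F$ of $M$; an induced minor is any matroid obtained from $M$ by a sequence of contractions (followed by simplification) and restrictions to flats. A member of $\mathcal{N}$ is induced-minor-minimal if none of its proper induced minors is in $\mathcal{N}$. -}

module Defs where

open import Data.Nat using (ℕ; _<_)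
open import Data.Fin using (Fin)
open import Data.Fin.Subset using (Subset; _∈_; _∉_; _⊆_; ∣_∣; ⁅_⁆; _∪_)
open import Data.Fin.Subset renaming (⊥ to ∅)
open import Data.Product using (Σ; ∃; _×_; _,_)
open import Data.Sum using (_⊎_)
open import Function.Bundles using (_⇔_)
open import Function.Definitions using (Injective)
open import Relation.Binary.PropositionalEquality using (_≡_; _≢_)
open import Relation.Nullary using (¬_)

record Matroid : Set₁ where
  field
    size      : ℕ
    Indep     : Subset size → Set
    indep-∅   : Indep ∅
    indep-⊆   : ∀ {I J} → J ⊆ I → Indep I → Indep J
    indep-aug : ∀ {I J} → Indep I → Indep J → ∣ I ∣ < ∣ J ∣ →
                ∃ λ x → x ∈ J × x ∉ I × Indep (⁅ x ⁆ ∪ I)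

open Matroid public

Simple : Matroid → Set
Simple M = (∀ x → Indep M ⁅ x ⁆) × (∀ x y → x ≢ y → Indep M (⁅ x ⁆ ∪ ⁅ y ⁆))

IsBasisOf : (M : Matroid) → Subset (size M) → Subset (size M) → Set
IsBasisOf M B X = B ⊆ X × Indep M B × (∀ x → x ∈ X → x ∉ B → ¬ Indep M (⁅ x ⁆ ∪ B))

InClosure : (M : Matroid) → Subset (size M) → Fin (size M) → Set
InClosure M X x = x ∈ X ⊎ (∃ λ B → IsBasisOf M B X × ¬ Indep M (⁅ x ⁆ ∪ B))

Flat : (M : Matroid) → Subset (size M) → Set
Flat M F = ∀ x → InClosure M F x → x ∈ F

IsImage : ∀ {n m} → (Fin n → Fin m) → Subset n → Subset m → Set
IsImage φ I J = ∀ y → (y ∈ J ⇔ (∃ λ x → x ∈ I × φ x ≡ y))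

PreservesIndep : (N M : Matroid) → (Fin (size N) → Fin (size M)) → Set
PreservesIndep N M φ =
  ∀ I J → IsImage φ I J → (Indep N I ⇔ Indep M J)

Iso : Matroid → Matroid → Set
Iso N M = Σ (Fin (size N) → Fin (size M)) λ φ →
  Injective _≡_ _≡_ φ × (∀ y → ∃ λ x → φ x ≡ y) × PreservesIndep N M φ

IsoIndRestr : Matroid → Matroid → Set
IsoIndRestr N M = Σ (Subset (size M)) λ F → Flat M F ×
  (Σ (Fin (size N) → Fin (size M)) λ φ →
     Injective _≡_ _≡_ φ × (∀ y → (y ∈ F ⇔ (∃ λ x → φ x ≡ y))) ×
     PreservesIndep N M φ)

-- Parallel elements of the contraction M/e (e a non-loop of M).
ParallelInContr : (M : Matroid) → Fin (size M) → Fin (size M) → Fin (size M) → Set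
ParallelInContr M e f g =
  f ≢ g × Indep M (⁅ e ⁆ ∪ ⁅ f ⁆) × Indep M (⁅ e ⁆ ∪ ⁅ g ⁆) ×
  ¬ Indep M (⁅ e ⁆ ∪ (⁅ f ⁆ ∪ ⁅ g ⁆))

-- N is isomorphic to si(M/e): N's elements are sent by φ to one
-- representative of each parallel class of non-loops of M/e, and
-- I is independent in N iff φ(I) ∪ {e} is independent in M.
IsoSiContr : Matroid → (M : Matroid) → Fin (size M) → Set
IsoSiContr N M e = Σ (Fin (size N) → Fin (size M)) λ φ →
  Injective _≡_ _≡_ φ ×
  (∀ x → φ x ≢ e) ×
  (∀ x → Indep M (⁅ e ⁆ ∪ ⁅ φ x ⁆)) ×
  (∀ f → f ≢ e → Indep M (⁅ e ⁆ ∪ ⁅ f ⁆) →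
     ∃ λ x → φ x ≡ f ⊎ ParallelInContr M e (φ x) f) ×
  (∀ x y → x ≢ y → ¬ ParallelInContr M e (φ x) (φ y)) ×
  (∀ I J → IsImage φ I J → (Indep N I ⇔ Indep M (⁅ e ⁆ ∪ J)))

-- Induced minors (up to isomorphism): a finite sequence of
-- contractions (each followed by simplification) and restrictions
-- to flats.

data IsoIndMinor : Matroid → Matroid → Set₁ where
  iso      : ∀ {N M} → Iso N M → IsoIndMinor N M
  contract : ∀ {N K M} (e : Fin (size K)) →
             IsoSiContr N K e → IsoIndMinor K M → IsoIndMinor N M
  restrict : ∀ {N K M} → IsoIndRestr N K → IsoIndMinor K M → IsoIndMinor N M

Class : Set₂
Class = Matroid → Set₁

ClosedUnderIso : Class → Set₁
ClosedUnderIso 𝒩 = ∀ {M M'} → Iso M M' → 𝒩 M → 𝒩 M'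

ClassOfSimple : Class → Set₁
ClassOfSimple 𝒩 = ∀ M → 𝒩 M → Simple M

-- Proper induced minor: induced minor with strictly smaller ground set
-- (i.e. obtained by at least one non-trivial operation).
ProperIsoIndMinor : Matroid → Matroid → Set₁
ProperIsoIndMinor N M = IsoIndMinor N M × size N < size M

MinimalMembers : Class → Class
MinimalMembers 𝒩 M = 𝒩 M × (∀ N → ProperIsoIndMinor N M → ¬ 𝒩 N)

{-# OPTIONS --safe #-}

-- If M has an induced restriction in 𝒩, then it has an induced minor in 𝒩, and one of least
-- size is induced-minor-minimal. Conversely, having no induced restriction in 𝒩 passes from M
-- to every induced minor of M. For restrictions this holds because a flat of a flat is a flat.
-- For a contraction, if K ≅ si(N/e) and Y ≅ K|F with F a flat of K, then Y ≅ si((N|G)/e) for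
-- the flat G of N spanned by e and the elements representing F; the hypothesis on 𝒩, applied
-- to N|G, turns an 𝒩-restriction Y of K into one of N|G and hence of N. Independence is not
-- assumed decidable, but every conclusion is a negation, so ¬¬-decidable makes it available.

module Submission where

open import Defs
open import Data.Nat using (ℕ; zero; suc; _≤_; _<_; _+_; _∸_; s≤s; z≤n)
import Data.Nat.Properties as ℕ
open import Data.Fin using (Fin; zero; suc; _≟_; lift)
open import Data.Fin.Properties using (any?; suc-injective; lift-injective)
open import Data.Fin.Subset
  using (Subset; inside; outside; _∈_; _∉_; _⊆_; ∣_∣; ⁅_⁆; _∪_)
  renaming (⊥ to ∅; ⊤ to Full)
open import Data.Fin.Subset.Properties
open import Data.Vec using ([]; _∷_; here; there)
import Data.Product
open import Data.Product using (Σ; Σ-syntax; ∃; _×_; _,_; proj₁; proj₂)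
import Data.Sum
open import Data.Sum using (_⊎_; inj₁; inj₂; [_,_]′)
open import Data.Empty using (⊥-elim)
open import Function using (_∘_; id)
open import Function.Bundles using (_⇔_; mk⇔; Equivalence)
open import Function.Definitions using (Injective)
open import Function.Properties.Equivalence using () renaming (refl to ⇔-refl; trans to ⇔-trans)
open import Relation.Binary.PropositionalEquality
open import Relation.Nullary using (¬_; yes; no; does)
open import Relation.Nullary.Decidable using (¬¬-excluded-middle; _×-dec_; _⊎-dec_; ¬?)
open import Relation.Unary using (Decidable)

open Equivalence using (to; from)

private
  variable
    n m k : ℕ

-- Subsets, images and enumerations

∪-lub : {p q r : Subset n} → p ⊆ r → q ⊆ r → p ∪ q ⊆ r
∪-lub {p = p} {q} p⊆r q⊆r x∈p∪q = [ p⊆r , q⊆r ]′ (x∈p∪q⁻ p q x∈p∪q)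

⁅x⁆⊆p : {x : Fin n} {p : Subset n} → x ∈ p → ⁅ x ⁆ ⊆ p
⁅x⁆⊆p {x = x} x∈p y∈⁅x⁆ rewrite x∈⁅y⁆⇒x≡y x y∈⁅x⁆ = x∈p

∣⁅x⁆∪p∣≡1+∣p∣ : (x : Fin n) (p : Subset n) → x ∉ p → ∣ ⁅ x ⁆ ∪ p ∣ ≡ suc ∣ p ∣
∣⁅x⁆∪p∣≡1+∣p∣ zero    (inside  ∷ p) x∉p = ⊥-elim (x∉p here)
∣⁅x⁆∪p∣≡1+∣p∣ zero    (outside ∷ p) _   = cong (suc ∘ ∣_∣) (∪-identityˡ p)
∣⁅x⁆∪p∣≡1+∣p∣ (suc x) (inside  ∷ p) x∉p = cong suc (∣⁅x⁆∪p∣≡1+∣p∣ x p (x∉p ∘ there))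
∣⁅x⁆∪p∣≡1+∣p∣ (suc x) (outside ∷ p) x∉p = ∣⁅x⁆∪p∣≡1+∣p∣ x p (x∉p ∘ there)

p⊆q∧∣q∣≤∣p∣⇒q⊆p : {p q : Subset n} → p ⊆ q → ∣ q ∣ ≤ ∣ p ∣ → q ⊆ p
p⊆q∧∣q∣≤∣p∣⇒q⊆p {p = p} p⊆q ∣q∣≤∣p∣ {x} x∈q with x ∈? p
... | yes x∈p = x∈p
... | no  x∉p = ⊥-elim (ℕ.<⇒≱ (p⊂q⇒∣p∣<∣q∣ (p⊆q , x , x∈q , x∉p)) ∣q∣≤∣p∣)

∪-leftComm : (p q r : Subset n) → p ∪ (q ∪ r) ≡ q ∪ (p ∪ r)
∪-leftComm p q r = trans (sym (∪-assoc p q r)) (trans (cong (_∪ r) (∪-comm p q)) (∪-assoc q p r))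

fromDecidable : {P : Fin n → Set} → Decidable P → Subset n
fromDecidable {n = zero}  P? = []
fromDecidable {n = suc n} P? = does (P? zero) ∷ fromDecidable (P? ∘ suc)

∈-fromDecidable⁺ : {P : Fin n → Set} (P? : Decidable P) {x : Fin n} → P x → x ∈ fromDecidable P?
∈-fromDecidable⁺ P? {zero} Px with P? zero
... | yes _  = here
... | no ¬Px = ⊥-elim (¬Px Px)
∈-fromDecidable⁺ P? {suc x} Px = there (∈-fromDecidable⁺ (P? ∘ suc) Px)

∈-fromDecidable⁻ : {P : Fin n → Set} (P? : Decidable P) {x : Fin n} → x ∈ fromDecidable P? → P x
∈-fromDecidable⁻ P? {zero} x∈ with P? zero | x∈
... | yes Px | _ = Px
... | no _   | ()
∈-fromDecidable⁻ P? {suc x} (there x∈) = ∈-fromDecidable⁻ (P? ∘ suc) x∈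

image : (Fin n → Fin m) → Subset n → Subset m
image φ []            = ∅
image φ (outside ∷ I) = image (φ ∘ suc) I
image φ (inside  ∷ I) = ⁅ φ zero ⁆ ∪ image (φ ∘ suc) I

∈-image⁺ : (φ : Fin n → Fin m) {I : Subset n} {x : Fin n} → x ∈ I → φ x ∈ image φ I
∈-image⁺ φ {inside  ∷ I} here       = p⊆p∪q (image (φ ∘ suc) I) (x∈⁅x⁆ (φ zero))
∈-image⁺ φ {inside  ∷ I} (there x∈) = q⊆p∪q ⁅ φ zero ⁆ _ (∈-image⁺ (φ ∘ suc) x∈)
∈-image⁺ φ {outside ∷ I} (there x∈) = ∈-image⁺ (φ ∘ suc) x∈

∈-image⁻ : (φ : Fin n → Fin m) (I : Subset n) {y : Fin m} →
           y ∈ image φ I → ∃ λ x → x ∈ I × φ x ≡ y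
∈-image⁻ φ [] y∈ = ⊥-elim (∉⊥ y∈)
∈-image⁻ φ (outside ∷ I) y∈ with ∈-image⁻ (φ ∘ suc) I y∈
... | x , x∈I , φx≡y = suc x , there x∈I , φx≡y
∈-image⁻ φ (inside ∷ I) y∈ with x∈p∪q⁻ ⁅ φ zero ⁆ (image (φ ∘ suc) I) y∈
... | inj₁ y∈⁅φ0⁆ = zero , here , sym (x∈⁅y⁆⇒x≡y _ y∈⁅φ0⁆)
... | inj₂ y∈′ with ∈-image⁻ (φ ∘ suc) I y∈′
...   | x , x∈I , φx≡y = suc x , there x∈I , φx≡y

image-isImage : (φ : Fin n → Fin m) (I : Subset n) → IsImage φ I (image φ I)
image-isImage φ I y = mk⇔ (∈-image⁻ φ I) λ { (x , x∈I , refl) → ∈-image⁺ φ x∈I }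

isImage⇒≡image : {φ : Fin n → Fin m} {I : Subset n} {J : Subset m} →
                 IsImage φ I J → J ≡ image φ I
isImage⇒≡image {φ = φ} {I} im = ⊆-antisym
  (λ {y} y∈J → from (image-isImage φ I y) (to (im y) y∈J))
  (λ {y} y∈  → from (im y) (to (image-isImage φ I y) y∈))

image-mono : (φ : Fin n → Fin m) {I J : Subset n} → I ⊆ J → image φ I ⊆ image φ J
image-mono φ {I} I⊆J y∈ with ∈-image⁻ φ I y∈
... | x , x∈I , refl = ∈-image⁺ φ (I⊆J x∈I)

image-⁅⁆ : (φ : Fin n → Fin m) (x : Fin n) → image φ ⁅ x ⁆ ≡ ⁅ φ x ⁆
image-⁅⁆ φ x = ⊆-antisym forward (⁅x⁆⊆p (∈-image⁺ φ (x∈⁅x⁆ x)))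
  where
  forward : image φ ⁅ x ⁆ ⊆ ⁅ φ x ⁆
  forward y∈ with ∈-image⁻ φ ⁅ x ⁆ y∈
  ... | x′ , x′∈⁅x⁆ , refl rewrite x∈⁅y⁆⇒x≡y x x′∈⁅x⁆ = x∈⁅x⁆ (φ x)

image-∪ : (φ : Fin n → Fin m) (p q : Subset n) → image φ (p ∪ q) ≡ image φ p ∪ image φ q
image-∪ φ p q = ⊆-antisym forward (∪-lub (image-mono φ (p⊆p∪q {p = p} q)) (image-mono φ (q⊆p∪q p q)))
  where
  forward : image φ (p ∪ q) ⊆ image φ p ∪ image φ q
  forward y∈ with ∈-image⁻ φ (p ∪ q) y∈
  ... | x , x∈p∪q , refl =
    [ p⊆p∪q (image φ q) ∘ ∈-image⁺ φ , q⊆p∪q (image φ p) _ ∘ ∈-image⁺ φ ]′ (x∈p∪q⁻ p q x∈p∪q)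

image-∘ : (φ : Fin n → Fin m) (ψ : Fin m → Fin k) (I : Subset n) →
          image (ψ ∘ φ) I ≡ image ψ (image φ I)
image-∘ φ ψ I = ⊆-antisym forward backward
  where
  forward : image (ψ ∘ φ) I ⊆ image ψ (image φ I)
  forward z∈ with ∈-image⁻ (ψ ∘ φ) I z∈
  ... | x , x∈I , refl = ∈-image⁺ ψ (∈-image⁺ φ x∈I)
  backward : image ψ (image φ I) ⊆ image (ψ ∘ φ) I
  backward z∈ with ∈-image⁻ ψ (image φ I) z∈
  ... | y , y∈ , refl with ∈-image⁻ φ I y∈
  ...   | x , x∈I , refl = ∈-image⁺ (ψ ∘ φ) x∈I

∣image∣ : (φ : Fin n → Fin m) → Injective _≡_ _≡_ φ → (I : Subset n) → ∣ image φ I ∣ ≡ ∣ I ∣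
∣image∣ {m = m} φ _ [] = ∣⊥∣≡0 m
∣image∣ φ φ-inj (outside ∷ I) = ∣image∣ (φ ∘ suc) (suc-injective ∘ φ-inj) I
∣image∣ φ φ-inj (inside  ∷ I) = begin
  ∣ ⁅ φ zero ⁆ ∪ image (φ ∘ suc) I ∣ ≡⟨ ∣⁅x⁆∪p∣≡1+∣p∣ (φ zero) _ φ0∉ ⟩
  suc ∣ image (φ ∘ suc) I ∣         ≡⟨ cong suc (∣image∣ (φ ∘ suc) (suc-injective ∘ φ-inj) I) ⟩
  suc ∣ I ∣                         ∎
  where
  open ≡-Reasoning
  φ0∉ : φ zero ∉ image (φ ∘ suc) I
  φ0∉ φ0∈ with ∈-image⁻ (φ ∘ suc) I φ0∈
  ... | x , _ , φsx≡φ0 with φ-inj φsx≡φ0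
  ...   | ()

image-cong : {φ φ′ : Fin n → Fin m} → (∀ x → φ x ≡ φ′ x) → (I : Subset n) → image φ I ≡ image φ′ I
image-cong φ≗φ′ []            = refl
image-cong φ≗φ′ (outside ∷ I) = image-cong (φ≗φ′ ∘ suc) I
image-cong φ≗φ′ (inside  ∷ I) = cong₂ _∪_ (cong ⁅_⁆ (φ≗φ′ zero)) (image-cong (φ≗φ′ ∘ suc) I)

image-pair : (φ : Fin n → Fin m) (a b : Fin n) → image φ (⁅ a ⁆ ∪ ⁅ b ⁆) ≡ ⁅ φ a ⁆ ∪ ⁅ φ b ⁆
image-pair φ a b = trans (image-∪ φ ⁅ a ⁆ ⁅ b ⁆) (cong₂ _∪_ (image-⁅⁆ φ a) (image-⁅⁆ φ b))

image-triple : (φ : Fin n → Fin m) (a b c : Fin n) →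
               image φ (⁅ a ⁆ ∪ (⁅ b ⁆ ∪ ⁅ c ⁆)) ≡ ⁅ φ a ⁆ ∪ (⁅ φ b ⁆ ∪ ⁅ φ c ⁆)
image-triple φ a b c = trans (image-∪ φ ⁅ a ⁆ _) (cong₂ _∪_ (image-⁅⁆ φ a) (image-pair φ b c))

preimage : (Fin n → Fin m) → Subset m → Subset n
preimage φ B = fromDecidable (λ x → φ x ∈? B)

∈-preimage⁻ : (φ : Fin n → Fin m) {B : Subset m} {x : Fin n} → x ∈ preimage φ B → φ x ∈ B
∈-preimage⁻ φ {B} = ∈-fromDecidable⁻ (λ x → φ x ∈? B)

image-preimage : (φ : Fin n → Fin m) {B : Subset m} → (∀ {y} → y ∈ B → ∃ λ x → φ x ≡ y) →
                 image φ (preimage φ B) ≡ B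
image-preimage φ {B} B⊆range = ⊆-antisym forward backward
  where
  forward : image φ (preimage φ B) ⊆ B
  forward y∈ with ∈-image⁻ φ (preimage φ B) y∈
  ... | x , x∈ , refl = ∈-preimage⁻ φ x∈
  backward : B ⊆ image φ (preimage φ B)
  backward y∈B with B⊆range y∈B
  ... | x , refl = ∈-image⁺ φ (∈-fromDecidable⁺ (λ x → φ x ∈? B) y∈B)

IsRange : (Fin n → Fin m) → Subset m → Set
IsRange φ G = ∀ y → y ∈ G ⇔ ∃ λ x → φ x ≡ y

enumerate : (G : Subset m) → Σ[ k ∈ ℕ ] Σ[ ι ∈ (Fin k → Fin m) ] Injective _≡_ _≡_ ι × IsRange ι G
enumerate [] = 0 , (λ ()) , (λ { {()} }) , λ ()
enumerate (outside ∷ G) with enumerate G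
... | k , ι , ι-inj , ι-range = k , suc ∘ ι , ι-inj ∘ suc-injective , range
  where
  range : IsRange (suc ∘ ι) (outside ∷ G)
  range zero    = mk⇔ (λ ()) λ ()
  range (suc y) = mk⇔ (λ { (there y∈G) → Data.Product.map₂ (cong suc) (to (ι-range y) y∈G) })
                      (λ { (x , ιx≡y) → there (from (ι-range y) (x , suc-injective ιx≡y)) })
enumerate (inside ∷ G) with enumerate G
... | k , ι , ι-inj , ι-range = suc k , lift 1 ι , lift-injective ι ι-inj 1 , range
  where
  range : IsRange (lift 1 ι) (inside ∷ G)
  range zero    = mk⇔ (λ _ → zero , refl) (λ _ → here)
  range (suc y) = mk⇔ (λ { (there y∈G) → Data.Product.map suc (cong suc) (to (ι-range y) y∈G) })
                      (λ { (zero , ())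
                         ; (suc x , ιx≡y) → there (from (ι-range y) (x , suc-injective ιx≡y)) })

isRange-∘ : {ω : Fin k → Fin n} {H : Subset n} (ι : Fin n → Fin m) →
            IsRange ω H → IsRange (ι ∘ ω) (image ι H)
isRange-∘ {ω = ω} {H} ι ω-range y = mk⇔ forward backward
  where
  forward : y ∈ image ι H → ∃ λ x → ι (ω x) ≡ y
  forward y∈ with ∈-image⁻ ι H y∈
  ... | h , h∈H , refl with to (ω-range h) h∈H
  ...   | x , refl = x , refl
  backward : (∃ λ x → ι (ω x) ≡ y) → y ∈ image ι H
  backward (x , refl) = ∈-image⁺ ι (from (ω-range (ω x)) (x , refl))

RespectsImage : (Fin n → Fin m) → (Subset n → Set) → (Subset m → Set) → Set
RespectsImage φ P Q = ∀ I J → IsImage φ I J → (P I ⇔ Q J)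

module _ {φ : Fin n → Fin m} {P : Subset n → Set} {Q : Subset m → Set} where

  respectsImage⁺ : (∀ I → P I ⇔ Q (image φ I)) → RespectsImage φ P Q
  respectsImage⁺ P⇔Qimage I J im = subst (λ J → P I ⇔ Q J) (sym (isImage⇒≡image im)) (P⇔Qimage I)

  respectsImage⁻ : RespectsImage φ P Q → ∀ I → P I ⇔ Q (image φ I)
  respectsImage⁻ resp I = resp I (image φ I) (image-isImage φ I)

respectsImage-∘ : {φ : Fin n → Fin m} {ψ : Fin m → Fin k}
                  {P : Subset n → Set} {Q : Subset m → Set} {R : Subset k → Set} →
                  RespectsImage φ P Q → RespectsImage ψ Q R → RespectsImage (ψ ∘ φ) P R
respectsImage-∘ {φ = φ} {ψ} {R = R} φ-resp ψ-resp = respectsImage⁺ λ I →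
  ⇔-trans (respectsImage⁻ φ-resp I)
          (subst (λ J → _ ⇔ R J) (sym (image-∘ φ ψ I)) (respectsImage⁻ ψ-resp (image φ I)))

-- Independence, bases and closed sets

¬¬-decidable : (P : Subset n → Set) → ¬ ¬ Decidable P
¬¬-decidable {zero}  P k = ¬¬-excluded-middle λ P[]? → k λ { [] → P[]? }
¬¬-decidable {suc n} P k =
  ¬¬-decidable (P ∘ (inside ∷_))  λ P-in?  →
  ¬¬-decidable (P ∘ (outside ∷_)) λ P-out? →
  k λ { (inside ∷ I) → P-in? I ; (outside ∷ I) → P-out? I }

DecIndep : Matroid → Set
DecIndep M = Decidable (Indep M)

Closed : (M : Matroid) → Subset (size M) → Set
Closed M X = ∀ {x} → x ∉ X → ∀ {B} → B ⊆ X → Indep M B → Indep M (⁅ x ⁆ ∪ B)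

module _ (M : Matroid) where

  extend-indep : ∀ {I J} → Indep M I → Indep M J → ∣ I ∣ ≤ ∣ J ∣ →
                 ∃ λ T → I ⊆ T × T ⊆ I ∪ J × Indep M T × ∣ T ∣ ≡ ∣ J ∣
  extend-indep {I} {J} iI iJ ∣I∣≤∣J∣ = go (∣ J ∣ ∸ ∣ I ∣) iI (ℕ.m+[n∸m]≡n ∣I∣≤∣J∣)
    where
    go : ∀ k {I} → Indep M I → ∣ I ∣ + k ≡ ∣ J ∣ →
         ∃ λ T → I ⊆ T × T ⊆ I ∪ J × Indep M T × ∣ T ∣ ≡ ∣ J ∣
    go zero {I} iI ∣I∣+0≡∣J∣ = I , id , p⊆p∪q J , iI , trans (sym (ℕ.+-identityʳ _)) ∣I∣+0≡∣J∣
    go (suc k) {I} iI ∣I∣+1+k≡∣J∣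
      with indep-aug M iI iJ (subst (∣ I ∣ <_) ∣I∣+1+k≡∣J∣ (ℕ.m<m+n ∣ I ∣ (s≤s z≤n)))
    ... | x , x∈J , x∉I , ixI with go k ixI (begin
            ∣ ⁅ x ⁆ ∪ I ∣ + k ≡⟨ cong (_+ k) (∣⁅x⁆∪p∣≡1+∣p∣ x I x∉I) ⟩
            suc ∣ I ∣ + k     ≡⟨ sym (ℕ.+-suc ∣ I ∣ k) ⟩
            ∣ I ∣ + suc k     ≡⟨ ∣I∣+1+k≡∣J∣ ⟩
            ∣ J ∣             ∎)
      where open ≡-Reasoning
    ...   | T , xI⊆T , T⊆xI∪J , iT , ∣T∣≡∣J∣ =
      T , xI⊆T ∘ q⊆p∪q ⁅ x ⁆ I , xI∪J⊆I∪J ∘ T⊆xI∪J , iT , ∣T∣≡∣J∣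
      where
      xI∪J⊆I∪J : (⁅ x ⁆ ∪ I) ∪ J ⊆ I ∪ J
      xI∪J⊆I∪J = ∪-lub (∪-lub (q⊆p∪q I J ∘ ⁅x⁆⊆p x∈J) (p⊆p∪q J)) (q⊆p∪q I J)

  dependent-triple⇒parallel : ∀ {e a b} → Indep M (⁅ e ⁆ ∪ ⁅ a ⁆) → Indep M (⁅ e ⁆ ∪ ⁅ b ⁆) →
                              ¬ Indep M (⁅ e ⁆ ∪ (⁅ a ⁆ ∪ ⁅ b ⁆)) → ParallelInContr M e a b
  dependent-triple⇒parallel {e} {a} {b} iea ieb ¬ieab = a≢b , iea , ieb , ¬ieab
    where
    a≢b : a ≢ b
    a≢b refl = ¬ieab (subst (λ X → Indep M (⁅ e ⁆ ∪ X)) (sym (∪-idem ⁅ a ⁆)) iea)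

  parallel-sym : ∀ {e a b} → ParallelInContr M e a b → ParallelInContr M e b a
  parallel-sym {e} {a} {b} (a≢b , iea , ieb , ¬ieab) =
    a≢b ∘ sym , ieb , iea , ¬ieab ∘ subst (λ X → Indep M (⁅ e ⁆ ∪ X)) (∪-comm ⁅ b ⁆ ⁅ a ⁆)

  -- Extend {e, g} inside ⁅ f ⁆ ∪ S to the same size: since {e, f, g} is dependent the result
  -- avoids f, so it is ⁅ g ⁆ ∪ S.
  parallel-exchange : ∀ {e f g S} → ParallelInContr M e f g → e ∈ S → f ∉ S → g ∉ S →
                      Indep M (⁅ f ⁆ ∪ S) → Indep M (⁅ g ⁆ ∪ S)
  parallel-exchange {e} {f} {g} {S} (_ , _ , ieg , ¬iefg) e∈S f∉S g∉S ifS
    with extend-indep ieg ifS ∣eg∣≤∣fS∣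
    where
    ∣eg∣≤∣fS∣ : ∣ ⁅ e ⁆ ∪ ⁅ g ⁆ ∣ ≤ ∣ ⁅ f ⁆ ∪ S ∣
    ∣eg∣≤∣fS∣ = begin
      ∣ ⁅ e ⁆ ∪ ⁅ g ⁆ ∣ ≡⟨ ∣⁅x⁆∪p∣≡1+∣p∣ e ⁅ g ⁆ (λ e∈⁅g⁆ → g∉S (subst (_∈ S) (x∈⁅y⁆⇒x≡y g e∈⁅g⁆) e∈S)) ⟩
      suc ∣ ⁅ g ⁆ ∣     ≡⟨ cong suc (trans (∣⁅x⁆∣≡1 g) (sym (∣⁅x⁆∣≡1 e))) ⟩
      suc ∣ ⁅ e ⁆ ∣     ≤⟨ s≤s (p⊆q⇒∣p∣≤∣q∣ (⁅x⁆⊆p e∈S)) ⟩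
      suc ∣ S ∣         ≡⟨ sym (∣⁅x⁆∪p∣≡1+∣p∣ f S f∉S) ⟩
      ∣ ⁅ f ⁆ ∪ S ∣     ∎
      where open ℕ.≤-Reasoning
  ... | T , eg⊆T , T⊆eg∪fS , iT , ∣T∣≡∣fS∣ = indep-⊆ M gS⊆T iT
    where
    f∉T : f ∉ T
    f∉T f∈T = ¬iefg (indep-⊆ M efg⊆T iT)
      where
      efg⊆T : ⁅ e ⁆ ∪ (⁅ f ⁆ ∪ ⁅ g ⁆) ⊆ T
      efg⊆T = ∪-lub (eg⊆T ∘ p⊆p∪q ⁅ g ⁆) (∪-lub (⁅x⁆⊆p f∈T) (eg⊆T ∘ q⊆p∪q ⁅ e ⁆ ⁅ g ⁆))
    T⊆gS : T ⊆ ⁅ g ⁆ ∪ S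
    T⊆gS {t} t∈T with x∈p∪q⁻ (⁅ e ⁆ ∪ ⁅ g ⁆) (⁅ f ⁆ ∪ S) (T⊆eg∪fS t∈T)
    ... | inj₁ t∈eg = [ q⊆p∪q ⁅ g ⁆ S ∘ ⁅x⁆⊆p e∈S , p⊆p∪q S ]′ (x∈p∪q⁻ ⁅ e ⁆ ⁅ g ⁆ t∈eg)
    ... | inj₂ t∈fS with x∈p∪q⁻ ⁅ f ⁆ S t∈fS
    ...   | inj₁ t∈⁅f⁆ = ⊥-elim (f∉T (subst (_∈ T) (x∈⁅y⁆⇒x≡y f t∈⁅f⁆) t∈T))
    ...   | inj₂ t∈S   = q⊆p∪q ⁅ g ⁆ S t∈S
    ∣gS∣≤∣T∣ : ∣ ⁅ g ⁆ ∪ S ∣ ≤ ∣ T ∣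
    ∣gS∣≤∣T∣ = ℕ.≤-reflexive (begin
      ∣ ⁅ g ⁆ ∪ S ∣ ≡⟨ ∣⁅x⁆∪p∣≡1+∣p∣ g S g∉S ⟩
      suc ∣ S ∣     ≡⟨ sym (∣⁅x⁆∪p∣≡1+∣p∣ f S f∉S) ⟩
      ∣ ⁅ f ⁆ ∪ S ∣ ≡⟨ sym ∣T∣≡∣fS∣ ⟩
      ∣ T ∣         ∎)
      where open ≡-Reasoning
    gS⊆T : ⁅ g ⁆ ∪ S ⊆ T
    gS⊆T = p⊆q∧∣q∣≤∣p∣⇒q⊆p T⊆gS ∣gS∣≤∣T∣

  extend-to-basis : DecIndep M → ∀ {X I} → I ⊆ X → Indep M I → ∃ λ B → I ⊆ B × IsBasisOf M B X
  extend-to-basis dec {X} {I} I⊆X iI = grow (size M) (ℕ.m≤m+n (size M) ∣ I ∣) I⊆X iI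
    where
    grow : ∀ fuel {I} → size M ≤ fuel + ∣ I ∣ → I ⊆ X → Indep M I → ∃ λ B → I ⊆ B × IsBasisOf M B X
    grow zero {I} ∣E∣≤∣I∣ I⊆X iI = I , id , I⊆X , iI , λ x _ x∉I _ → x∉I (subst (x ∈_) (sym I≡E) ∈⊤)
      where
      I≡E : I ≡ Full
      I≡E = ∣p∣≡n⇒p≡⊤ (ℕ.≤-antisym (∣p∣≤n I) ∣E∣≤∣I∣)
    grow (suc fuel) {I} ∣E∣≤1+fuel+∣I∣ I⊆X iI
      with any? (λ x → x ∈? X ×-dec ¬? (x ∈? I) ×-dec dec (⁅ x ⁆ ∪ I))
    ... | no ¬augmentable = I , id , I⊆X , iI , λ x x∈X x∉I ixI → ¬augmentable (x , x∈X , x∉I , ixI)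
    ... | yes (x , x∈X , x∉I , ixI) with grow fuel ∣E∣≤fuel+∣xI∣ (∪-lub (⁅x⁆⊆p x∈X) I⊆X) ixI
      where
      ∣E∣≤fuel+∣xI∣ : size M ≤ fuel + ∣ ⁅ x ⁆ ∪ I ∣
      ∣E∣≤fuel+∣xI∣ = subst (size M ≤_)
        (sym (trans (cong (fuel +_) (∣⁅x⁆∪p∣≡1+∣p∣ x I x∉I)) (ℕ.+-suc fuel ∣ I ∣))) ∣E∣≤1+fuel+∣I∣
    ...   | B , xI⊆B , B-basis = B , xI⊆B ∘ q⊆p∪q ⁅ x ⁆ I , B-basis

  indep≤basis : ∀ {X S B} → IsBasisOf M S X → B ⊆ X → Indep M B → ∣ B ∣ ≤ ∣ S ∣
  indep≤basis (S⊆X , iS , S-max) B⊆X iB = ℕ.≮⇒≥ λ ∣S∣<∣B∣ →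
    let (t , t∈B , t∉S , itS) = indep-aug M iS iB ∣S∣<∣B∣ in S-max t (B⊆X t∈B) t∉S itS

  closed⇒flat : ∀ {X} → Closed M X → Flat M X
  closed⇒flat X-closed x (inj₁ x∈X) = x∈X
  closed⇒flat {X} X-closed x (inj₂ (B , (B⊆X , iB , _) , ¬ixB)) with x ∈? X
  ... | yes x∈X = x∈X
  ... | no  x∉X = ⊥-elim (¬ixB (X-closed x∉X B⊆X iB))

  bases-extend⇒closed : DecIndep M → ∀ {X} →
                        (∀ {x} → x ∉ X → ∀ {B} → IsBasisOf M B X → Indep M (⁅ x ⁆ ∪ B)) → Closed M X
  bases-extend⇒closed dec extends x∉X B⊆X iB with extend-to-basis dec B⊆X iB
  ... | B′ , B⊆B′ , B′-basis = indep-⊆ M (∪-lub (p⊆p∪q B′) (q⊆p∪q _ B′ ∘ B⊆B′)) (extends x∉X B′-basis)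

  flat⇒closed : DecIndep M → ∀ {X} → Flat M X → Closed M X
  flat⇒closed dec {X} X-flat = bases-extend⇒closed dec extends
    where
    extends : ∀ {x} → x ∉ X → ∀ {B} → IsBasisOf M B X → Indep M (⁅ x ⁆ ∪ B)
    extends {x} x∉X {B} B-basis with dec (⁅ x ⁆ ∪ B)
    ... | yes ixB = ixB
    ... | no ¬ixB = ⊥-elim (x∉X (X-flat x (inj₂ (B , B-basis , ¬ixB))))

  -- Every basis of X is as large as S, so augmenting it from ⁅ x ⁆ ∪ S can only add x.
  basis-extends⇒closed : DecIndep M → ∀ {X S} → IsBasisOf M S X →
                         (∀ {x} → x ∉ X → Indep M (⁅ x ⁆ ∪ S)) → Closed M X
  basis-extends⇒closed dec {X} {S} S-basis@(S⊆X , _) S-extends = bases-extend⇒closed dec extends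
    where
    extends : ∀ {x} → x ∉ X → ∀ {B} → IsBasisOf M B X → Indep M (⁅ x ⁆ ∪ B)
    extends {x} x∉X {B} B-basis@(B⊆X , iB , B-max)
      with indep-aug M iB (S-extends x∉X)
             (subst (∣ B ∣ <_) (sym (∣⁅x⁆∪p∣≡1+∣p∣ x S (x∉X ∘ S⊆X)))
                    (s≤s (indep≤basis S-basis B⊆X iB)))
    ... | t , t∈xS , t∉B , itB with x∈p∪q⁻ ⁅ x ⁆ S t∈xS
    ...   | inj₁ t∈⁅x⁆ = subst (λ t → Indep M (⁅ t ⁆ ∪ B)) (x∈⁅y⁆⇒x≡y x t∈⁅x⁆) itB
    ...   | inj₂ t∈S   = ⊥-elim (B-max t (S⊆X t∈S) t∉B itB)

-- Simplicity, isomorphisms and induced restrictions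

simple-embedding : {A B : Matroid} (φ : Fin (size A) → Fin (size B)) → Injective _≡_ _≡_ φ →
                   PreservesIndep A B φ → Simple B → Simple A
simple-embedding {B = B} φ φ-inj φ-pres (B-loopless , B-noparallel) = loopless , noparallel
  where
  loopless = λ x → from (respectsImage⁻ φ-pres ⁅ x ⁆)
    (subst (Indep B) (sym (image-⁅⁆ φ x)) (B-loopless (φ x)))
  noparallel = λ x y x≢y → from (respectsImage⁻ φ-pres (⁅ x ⁆ ∪ ⁅ y ⁆))
    (subst (Indep B) (sym (image-pair φ x y)) (B-noparallel (φ x) (φ y) (x≢y ∘ φ-inj)))

simple-siContr : ∀ {N K e} → DecIndep K → IsoSiContr N K e → Simple N
simple-siContr {N} {K} {e} K-dec (ψ , ψ-inj , _ , ψ-nonloop , _ , ψ-nonparallel , ψ-indep) =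
  loopless , noparallel
  where
  loopless : ∀ x → Indep N ⁅ x ⁆
  loopless x = from (respectsImage⁻ ψ-indep ⁅ x ⁆)
    (subst (λ J → Indep K (⁅ e ⁆ ∪ J)) (sym (image-⁅⁆ ψ x)) (ψ-nonloop x))
  noparallel : ∀ x y → x ≢ y → Indep N (⁅ x ⁆ ∪ ⁅ y ⁆)
  noparallel x y x≢y = from (respectsImage⁻ ψ-indep (⁅ x ⁆ ∪ ⁅ y ⁆))
    (subst (λ J → Indep K (⁅ e ⁆ ∪ J)) (sym (image-pair ψ x y)) independent)
    where
    independent : Indep K (⁅ e ⁆ ∪ (⁅ ψ x ⁆ ∪ ⁅ ψ y ⁆))
    independent with K-dec (⁅ e ⁆ ∪ (⁅ ψ x ⁆ ∪ ⁅ ψ y ⁆))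
    ... | yes i = i
    ... | no ¬i = ⊥-elim (ψ-nonparallel x y x≢y (x≢y ∘ ψ-inj , ψ-nonloop x , ψ-nonloop y , ¬i))

simple-indRestr : ∀ {A M} → IsoIndRestr A M → Simple M → Simple A
simple-indRestr {A} {M} (_ , _ , ω , ω-inj , _ , ω-pres) = simple-embedding {A} {M} ω ω-inj ω-pres

Iso-refl : (M : Matroid) → Iso M M
Iso-refl M = id , id , (λ y → y , refl) ,
  λ I J im → subst (λ J → Indep M I ⇔ Indep M J) (id-image im) ⇔-refl
  where
  id-image : ∀ {I J} → IsImage id I J → I ≡ J
  id-image im = ⊆-antisym (λ {x} x∈I → from (im x) (x , x∈I , refl))
                          (λ {y} y∈J → id-preimage (to (im y) y∈J))
    where
    id-preimage : ∀ {I y} → (∃ λ x → x ∈ I × x ≡ y) → y ∈ I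
    id-preimage (x , x∈I , refl) = x∈I

Iso-trans : ∀ {A B C} → Iso A B → Iso B C → Iso A C
Iso-trans (θ , θ-inj , θ-surj , θ-pres) (θ′ , θ′-inj , θ′-surj , θ′-pres) =
  θ′ ∘ θ , θ-inj ∘ θ′-inj , surj , respectsImage-∘ θ-pres θ′-pres
  where
  surj : ∀ z → ∃ λ x → θ′ (θ x) ≡ z
  surj z with θ′-surj z
  ... | y , refl with θ-surj y
  ...   | x , refl = x , refl

iso-siContr : ∀ {A B K e} → Iso A B → IsoSiContr B K e → IsoSiContr A K e
iso-siContr {K = K} {e} (θ , θ-inj , θ-surj , θ-pres)
                        (ψ , ψ-inj , ψ≢e , ψ-nonloop , ψ-covers , ψ-nonparallel , ψ-indep) =
  ψ ∘ θ , θ-inj ∘ ψ-inj , ψ≢e ∘ θ , ψ-nonloop ∘ θ , covers ,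
  (λ x y x≢y → ψ-nonparallel (θ x) (θ y) (x≢y ∘ θ-inj)) , respectsImage-∘ θ-pres ψ-indep
  where
  covers : ∀ f → f ≢ e → Indep K (⁅ e ⁆ ∪ ⁅ f ⁆) →
           ∃ λ x → ψ (θ x) ≡ f ⊎ ParallelInContr K e (ψ (θ x)) f
  covers f f≢e ief with ψ-covers f f≢e ief
  ... | y , covered with θ-surj y
  ...   | x , refl = x , covered

iso-indRestr : ∀ {A B K} → Iso A B → IsoIndRestr B K → IsoIndRestr A K
iso-indRestr (θ , θ-inj , θ-surj , θ-pres) (F , F-flat , ω , ω-inj , ω-range , ω-pres) =
  F , F-flat , ω ∘ θ , θ-inj ∘ ω-inj , range , respectsImage-∘ θ-pres ω-pres
  where
  range : IsRange (ω ∘ θ) F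
  range y = mk⇔ forward (λ { (x , ωθx≡y) → from (ω-range y) (θ x , ωθx≡y) })
    where
    forward : y ∈ F → ∃ λ x → ω (θ x) ≡ y
    forward y∈F with to (ω-range y) y∈F
    ... | z , refl with θ-surj z
    ...   | x , refl = x , refl

iso-indMinor : ∀ {A B C} → Iso A B → IsoIndMinor B C → IsoIndMinor A C
iso-indMinor {A} {B} {C} θ (iso θ′) = iso (Iso-trans {A} {B} {C} θ θ′)
iso-indMinor {A} {B} θ (contract {K = K} e σ B≤C) =
  contract {K = K} e (iso-siContr {A} {B} {K} {e} θ σ) B≤C
iso-indMinor {A} {B} θ (restrict {K = K} ρ B≤C) = restrict {K = K} (iso-indRestr {A} {B} {K} θ ρ) B≤C

indMinor-trans : ∀ {A B C} → IsoIndMinor A B → IsoIndMinor B C → IsoIndMinor A C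
indMinor-trans (iso θ)                    B≤C = iso-indMinor θ B≤C
indMinor-trans (contract {K = K} e σ A≤B) B≤C = contract {K = K} e σ (indMinor-trans A≤B B≤C)
indMinor-trans (restrict {K = K} ρ A≤B)   B≤C = restrict {K = K} ρ (indMinor-trans A≤B B≤C)

iso⇒indRestr : ∀ {A M} → Iso A M → IsoIndRestr A M
iso⇒indRestr (θ , θ-inj , θ-surj , θ-pres) =
  Full , (λ _ _ → ∈⊤) , θ , θ-inj , (λ y → mk⇔ (λ _ → θ-surj y) (λ _ → ∈⊤)) , θ-pres

simple-indMinor : ∀ {K M} → IsoIndMinor K M → Simple M → ¬ ¬ Simple K
simple-indMinor {K} {M} (iso θ) M-simple k =
  k (simple-indRestr {K} {M} (iso⇒indRestr {K} {M} θ) M-simple)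
simple-indMinor {K} (restrict {K = K′} ρ K′≤M) M-simple k =
  simple-indMinor K′≤M M-simple (k ∘ simple-indRestr {K} {K′} ρ)
simple-indMinor {K} (contract {K = K′} e σ _) _ k =
  ¬¬-decidable (Indep K′) (k ∘ λ K′-dec → simple-siContr {K} {K′} {e} K′-dec σ)

restriction : (M : Matroid) (ι : Fin k → Fin (size M)) → Injective _≡_ _≡_ ι → Matroid
restriction {k} M ι ι-inj = record
  { size      = k
  ; Indep     = Indep M ∘ image ι
  ; indep-∅   = indep-⊆ M (λ y∈ → ⊥-elim (∉⊥ (proj₁ (proj₂ (∈-image⁻ ι ∅ y∈))))) (indep-∅ M)
  ; indep-⊆   = λ J⊆I → indep-⊆ M (image-mono ι J⊆I)
  ; indep-aug = augment
  }
  where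
  augment : ∀ {I J} → Indep M (image ι I) → Indep M (image ι J) → ∣ I ∣ < ∣ J ∣ →
            ∃ λ x → x ∈ J × x ∉ I × Indep M (image ι (⁅ x ⁆ ∪ I))
  augment {I} {J} iI iJ ∣I∣<∣J∣
    with indep-aug M iI iJ (subst₂ _<_ (sym (∣image∣ ι ι-inj I)) (sym (∣image∣ ι ι-inj J)) ∣I∣<∣J∣)
  ... | y , y∈ιJ , y∉ιI , iyιI with ∈-image⁻ ι J y∈ιJ
  ...   | x , x∈J , refl = x , x∈J , y∉ιI ∘ ∈-image⁺ ι ,
    subst (Indep M) (sym (trans (image-∪ ι ⁅ x ⁆ I) (cong (_∪ image ι I) (image-⁅⁆ ι x)))) iyιI

restriction-indRestr : (M : Matroid) {G : Subset (size M)} (ι : Fin k → Fin (size M))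
                       (ι-inj : Injective _≡_ _≡_ ι) → IsRange ι G → Closed M G →
                       IsoIndRestr (restriction M ι ι-inj) M
restriction-indRestr M ι ι-inj ι-range G-closed =
  _ , closed⇒flat M G-closed , ι , ι-inj , ι-range , respectsImage⁺ (λ _ → ⇔-refl)

image-closed : {K M : Matroid} {G : Subset (size M)} {H : Subset (size K)}
               (ι : Fin (size K) → Fin (size M)) → Injective _≡_ _≡_ ι → IsRange ι G →
               PreservesIndep K M ι → Closed M G → Closed K H → Closed M (image ι H)
image-closed {K} {M} {G} {H} ι ι-inj ι-range ι-pres G-closed H-closed {x} x∉ιH {B} B⊆ιH iB
  with x ∈? G
... | no x∉G = G-closed x∉G (ιH⊆G ∘ B⊆ιH) iB
  where
  ιH⊆G : image ι H ⊆ G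
  ιH⊆G y∈ with ∈-image⁻ ι H y∈
  ... | h , _ , refl = from (ι-range (ι h)) (h , refl)
... | yes x∈G with to (ι-range x) x∈G
...   | x₀ , refl =
  subst (Indep M) ι[x₀B₀]≡xB
    (to (respectsImage⁻ ι-pres (⁅ x₀ ⁆ ∪ B₀)) (H-closed (x∉ιH ∘ ∈-image⁺ ι) B₀⊆H iB₀))
  where
  B₀ = preimage ι B
  ιB₀≡B : image ι B₀ ≡ B
  ιB₀≡B = image-preimage ι B⊆range
    where
    B⊆range : ∀ {y} → y ∈ B → ∃ λ x → ι x ≡ y
    B⊆range y∈B with ∈-image⁻ ι H (B⊆ιH y∈B)
    ... | h , _ , ιh≡y = h , ιh≡y
  ι[x₀B₀]≡xB : image ι (⁅ x₀ ⁆ ∪ B₀) ≡ ⁅ ι x₀ ⁆ ∪ B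
  ι[x₀B₀]≡xB = trans (image-∪ ι ⁅ x₀ ⁆ B₀) (cong₂ _∪_ (image-⁅⁆ ι x₀) ιB₀≡B)
  B₀⊆H : B₀ ⊆ H
  B₀⊆H z∈B₀ with ∈-image⁻ ι H (B⊆ιH (∈-preimage⁻ ι z∈B₀))
  ... | h , h∈H , ιh≡ιz = subst (_∈ H) (ι-inj ιh≡ιz) h∈H
  iB₀ : Indep K B₀
  iB₀ = from (respectsImage⁻ ι-pres B₀) (subst (Indep M) (sym ιB₀≡B) iB)

indRestr-trans : ∀ {Y K M} → DecIndep K → DecIndep M →
                 IsoIndRestr Y K → IsoIndRestr K M → IsoIndRestr Y M
indRestr-trans {K = K} {M} K-dec M-dec (H , H-flat , ω , ω-inj , ω-range , ω-pres)
                                       (G , G-flat , ι , ι-inj , ι-range , ι-pres) =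
  image ι H , closed⇒flat M ιH-closed , ι ∘ ω , ω-inj ∘ ι-inj , isRange-∘ ι ω-range ,
  respectsImage-∘ ω-pres ι-pres
  where
  ιH-closed : Closed M (image ι H)
  ιH-closed = image-closed {K} {M} ι ι-inj ι-range ι-pres
                (flat⇒closed M M-dec G-flat) (flat⇒closed K K-dec H-flat)

-- Restricting a simplified contraction

-- N ≅ si((M|G)/e), described inside M.
IsoSiContrWithin : Matroid → (M : Matroid) → Fin (size M) → Subset (size M) → Set
IsoSiContrWithin N M e G = Σ (Fin (size N) → Fin (size M)) λ φ →
  Injective _≡_ _≡_ φ ×
  (∀ x → φ x ∈ G) ×
  (∀ x → φ x ≢ e) ×
  (∀ x → Indep M (⁅ e ⁆ ∪ ⁅ φ x ⁆)) ×
  (∀ f → f ∈ G → f ≢ e → Indep M (⁅ e ⁆ ∪ ⁅ f ⁆) →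
     ∃ λ x → φ x ≡ f ⊎ ParallelInContr M e (φ x) f) ×
  (∀ x y → x ≢ y → ¬ ParallelInContr M e (φ x) (φ y)) ×
  RespectsImage φ (Indep N) (λ J → Indep M (⁅ e ⁆ ∪ J))

module _ (M : Matroid) {G : Subset (size M)} (ι : Fin k → Fin (size M))
         (ι-inj : Injective _≡_ _≡_ ι) (ι-range : IsRange ι G) where

  private
    L = restriction M ι ι-inj

  parallel-restriction⁺ : ∀ {a b c} → ParallelInContr M (ι a) (ι b) (ι c) → ParallelInContr L a b c
  parallel-restriction⁺ {a} {b} {c} (ιb≢ιc , iab , iac , ¬iabc) =
    ιb≢ιc ∘ cong ι ,
    subst (Indep M) (sym (image-pair ι a b)) iab ,
    subst (Indep M) (sym (image-pair ι a c)) iac ,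
    ¬iabc ∘ subst (Indep M) (image-triple ι a b c)

  parallel-restriction⁻ : ∀ {a b c} → ParallelInContr L a b c → ParallelInContr M (ι a) (ι b) (ι c)
  parallel-restriction⁻ {a} {b} {c} (b≢c , iab , iac , ¬iabc) =
    b≢c ∘ ι-inj ,
    subst (Indep M) (image-pair ι a b) iab ,
    subst (Indep M) (image-pair ι a c) iac ,
    ¬iabc ∘ subst (Indep M) (sym (image-triple ι a b c))

  siContrWithin⇒siContr : ∀ {N e} → IsoSiContrWithin N M (ι e) G → IsoSiContr N L e
  siContrWithin⇒siContr {N} {e}
    (φ , φ-inj , φ∈G , φ≢e , φ-nonloop , φ-covers , φ-nonparallel , φ-indep) =
    φ′ , φ′-inj , φ′≢e , φ′-nonloop , φ′-covers , φ′-nonparallel , φ′-indep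
    where
    φ′ : Fin (size N) → Fin k
    φ′ x = proj₁ (to (ι-range (φ x)) (φ∈G x))
    ιφ′ : ∀ x → ι (φ′ x) ≡ φ x
    ιφ′ x = proj₂ (to (ι-range (φ x)) (φ∈G x))
    φ′-inj : Injective _≡_ _≡_ φ′
    φ′-inj {a} {b} φ′a≡φ′b = φ-inj (trans (sym (ιφ′ a)) (trans (cong ι φ′a≡φ′b) (ιφ′ b)))
    φ′≢e : ∀ x → φ′ x ≢ e
    φ′≢e x φ′x≡e = φ≢e x (trans (sym (ιφ′ x)) (cong ι φ′x≡e))
    φ′-nonloop : ∀ x → Indep L (⁅ e ⁆ ∪ ⁅ φ′ x ⁆)
    φ′-nonloop x = subst (Indep M)
      (sym (trans (image-pair ι e (φ′ x)) (cong (λ y → ⁅ ι e ⁆ ∪ ⁅ y ⁆) (ιφ′ x)))) (φ-nonloop x)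
    φ′-covers : ∀ f → f ≢ e → Indep L (⁅ e ⁆ ∪ ⁅ f ⁆) →
                ∃ λ x → φ′ x ≡ f ⊎ ParallelInContr L e (φ′ x) f
    φ′-covers f f≢e ief
      with φ-covers (ι f) (from (ι-range (ι f)) (f , refl)) (f≢e ∘ ι-inj)
                    (subst (Indep M) (image-pair ι e f) ief)
    ... | x , inj₁ φx≡ιf = x , inj₁ (ι-inj (trans (ιφ′ x) φx≡ιf))
    ... | x , inj₂ φx∥ιf =
      x , inj₂ (parallel-restriction⁺
                 (subst (λ y → ParallelInContr M (ι e) y (ι f)) (sym (ιφ′ x)) φx∥ιf))
    φ′-nonparallel : ∀ x y → x ≢ y → ¬ ParallelInContr L e (φ′ x) (φ′ y)
    φ′-nonparallel x y x≢y φ′x∥φ′y =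
      φ-nonparallel x y x≢y
        (subst₂ (ParallelInContr M (ι e)) (ιφ′ x) (ιφ′ y) (parallel-restriction⁻ φ′x∥φ′y))
    φ′-indep : RespectsImage φ′ (Indep N) (λ J → Indep L (⁅ e ⁆ ∪ J))
    φ′-indep = respectsImage⁺ λ I →
      subst (λ J → Indep N I ⇔ Indep M J) (sym (ι[e∪φ′I]≡ιe∪φI I)) (respectsImage⁻ φ-indep I)
      where
      ι[e∪φ′I]≡ιe∪φI : ∀ I → image ι (⁅ e ⁆ ∪ image φ′ I) ≡ ⁅ ι e ⁆ ∪ image φ I
      ι[e∪φ′I]≡ιe∪φI I = begin
        image ι (⁅ e ⁆ ∪ image φ′ I)          ≡⟨ image-∪ ι ⁅ e ⁆ (image φ′ I) ⟩
        image ι ⁅ e ⁆ ∪ image ι (image φ′ I)  ≡⟨ cong₂ _∪_ (image-⁅⁆ ι e) (sym (image-∘ φ′ ι I)) ⟩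
        ⁅ ι e ⁆ ∪ image (ι ∘ φ′) I            ≡⟨ cong (⁅ ι e ⁆ ∪_) (image-cong ιφ′ I) ⟩
        ⁅ ι e ⁆ ∪ image φ I                   ∎
        where open ≡-Reasoning

-- For K ≅ si(N/e) via ψ and a flat F of K, this describes the flat cl_N({e} ∪ ψ(F)) of N.
InLifted : (N : Matroid) (e : Fin (size N)) → (Fin k → Fin (size N)) → Subset k → Fin (size N) → Set
InLifted N e ψ F f = f ≡ e ⊎ ∃ λ z → z ∈ F × (ψ z ≡ f ⊎ ¬ Indep N (⁅ e ⁆ ∪ (⁅ ψ z ⁆ ∪ ⁅ f ⁆)))

module _ (N : Matroid) (N-dec : DecIndep N) (e : Fin (size N))
         (ψ : Fin k → Fin (size N)) (F : Subset k) where

  inLifted? : Decidable (InLifted N e ψ F)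
  inLifted? f =
    f ≟ e ⊎-dec any? λ z → z ∈? F ×-dec (ψ z ≟ f ⊎-dec ¬? (N-dec (⁅ e ⁆ ∪ (⁅ ψ z ⁆ ∪ ⁅ f ⁆))))

  lifted : Subset (size N)
  lifted = fromDecidable inLifted?

  ∈-lifted⁺ : ∀ {f} → InLifted N e ψ F f → f ∈ lifted
  ∈-lifted⁺ = ∈-fromDecidable⁺ inLifted?

  ∈-lifted⁻ : ∀ {f} → f ∈ lifted → InLifted N e ψ F f
  ∈-lifted⁻ = ∈-fromDecidable⁻ inLifted?

-- With C a basis of F, S = {e} ∪ ψ(C) is a basis of the lifted set that every element
-- outside it extends.
module _ {K N : Matroid} {e : Fin (size N)} {ψ : Fin (size K) → Fin (size N)}
         (N-simple : Simple N) (N-dec : DecIndep N)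
         (ψ-inj : Injective _≡_ _≡_ ψ) (ψ≢e : ∀ x → ψ x ≢ e)
         (ψ-nonloop : ∀ x → Indep N (⁅ e ⁆ ∪ ⁅ ψ x ⁆))
         (ψ-covers : ∀ f → f ≢ e → Indep N (⁅ e ⁆ ∪ ⁅ f ⁆) →
                       ∃ λ x → ψ x ≡ f ⊎ ParallelInContr N e (ψ x) f)
         (ψ-indep : RespectsImage ψ (Indep K) (λ J → Indep N (⁅ e ⁆ ∪ J)))
         {F C : Subset (size K)} (F-closed : Closed K F) (C-basis : IsBasisOf K C F) where

  private
    G = lifted N N-dec e ψ F

    ∈G⁺ : ∀ {f} → InLifted N e ψ F f → f ∈ G
    ∈G⁺ = ∈-lifted⁺ N N-dec e ψ F

    ∈G⁻ : ∀ {f} → f ∈ G → InLifted N e ψ F f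
    ∈G⁻ = ∈-lifted⁻ N N-dec e ψ F

    C⊆F   = proj₁ C-basis
    iC    = proj₁ (proj₂ C-basis)
    C-max = proj₂ (proj₂ C-basis)

    S : Subset (size N)
    S = ⁅ e ⁆ ∪ image ψ C

    e∈S : e ∈ S
    e∈S = p⊆p∪q (image ψ C) (x∈⁅x⁆ e)

    S⊆G : S ⊆ G
    S⊆G = ∪-lub (⁅x⁆⊆p (∈G⁺ (inj₁ refl))) ψC⊆G
      where
      ψC⊆G : image ψ C ⊆ G
      ψC⊆G y∈ with ∈-image⁻ ψ C y∈
      ... | z , z∈C , refl = ∈G⁺ (inj₂ (z , C⊆F z∈C , inj₁ refl))

    ψz∈S⇒z∈C : ∀ {z} → ψ z ∈ S → z ∈ C
    ψz∈S⇒z∈C {z} ψz∈S with x∈p∪q⁻ ⁅ e ⁆ (image ψ C) ψz∈S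
    ... | inj₁ ψz∈⁅e⁆ = ⊥-elim (ψ≢e z (x∈⁅y⁆⇒x≡y e ψz∈⁅e⁆))
    ... | inj₂ ψz∈ψC with ∈-image⁻ ψ C ψz∈ψC
    ...   | z′ , z′∈C , ψz′≡ψz = subst (_∈ C) (ψ-inj ψz′≡ψz) z′∈C

    indep-over-C⇔over-S : ∀ z → Indep K (⁅ z ⁆ ∪ C) ⇔ Indep N (⁅ ψ z ⁆ ∪ S)
    indep-over-C⇔over-S z =
      subst (λ J → Indep K (⁅ z ⁆ ∪ C) ⇔ Indep N J) e∪ψ[zC]≡ψz∪S (respectsImage⁻ ψ-indep (⁅ z ⁆ ∪ C))
      where
      e∪ψ[zC]≡ψz∪S : ⁅ e ⁆ ∪ image ψ (⁅ z ⁆ ∪ C) ≡ ⁅ ψ z ⁆ ∪ S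
      e∪ψ[zC]≡ψz∪S = begin
        ⁅ e ⁆ ∪ image ψ (⁅ z ⁆ ∪ C)   ≡⟨ cong (⁅ e ⁆ ∪_) (image-∪ ψ ⁅ z ⁆ C) ⟩
        ⁅ e ⁆ ∪ (image ψ ⁅ z ⁆ ∪ image ψ C) ≡⟨ cong (λ X → ⁅ e ⁆ ∪ (X ∪ image ψ C)) (image-⁅⁆ ψ z) ⟩
        ⁅ e ⁆ ∪ (⁅ ψ z ⁆ ∪ image ψ C) ≡⟨ ∪-leftComm ⁅ e ⁆ ⁅ ψ z ⁆ (image ψ C) ⟩
        ⁅ ψ z ⁆ ∪ S                   ∎
        where open ≡-Reasoning

    iS : Indep N S
    iS = to (respectsImage⁻ ψ-indep C) iC

    pair-indep : ∀ {g} → g ∉ S → Indep N (⁅ e ⁆ ∪ ⁅ g ⁆)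
    pair-indep g∉S = proj₂ N-simple _ _ λ { refl → g∉S e∈S }

    S-maximal : ∀ g → g ∈ G → g ∉ S → ¬ Indep N (⁅ g ⁆ ∪ S)
    S-maximal g g∈G g∉S igS with ∈G⁻ g∈G
    ... | inj₁ refl = g∉S e∈S
    ... | inj₂ (c , c∈F , inj₁ refl) =
      C-max c c∈F (g∉S ∘ q⊆p∪q ⁅ e ⁆ _ ∘ ∈-image⁺ ψ) (from (indep-over-C⇔over-S c) igS)
    ... | inj₂ (c , c∈F , inj₂ ¬ie[ψc]g) with c ∈? C
    ...   | yes c∈C = ¬ie[ψc]g (indep-⊆ N e[ψc]g⊆gS igS)
      where
      e[ψc]g⊆gS : ⁅ e ⁆ ∪ (⁅ ψ c ⁆ ∪ ⁅ g ⁆) ⊆ ⁅ g ⁆ ∪ S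
      e[ψc]g⊆gS = ∪-lub (q⊆p∪q ⁅ g ⁆ S ∘ ⁅x⁆⊆p e∈S)
                    (∪-lub (q⊆p∪q ⁅ g ⁆ S ∘ ⁅x⁆⊆p (q⊆p∪q ⁅ e ⁆ _ (∈-image⁺ ψ c∈C))) (p⊆p∪q S))
    ...   | no c∉C = C-max c c∈F c∉C (from (indep-over-C⇔over-S c)
                       (parallel-exchange N (parallel-sym N ψc∥g) e∈S g∉S (c∉C ∘ ψz∈S⇒z∈C) igS))
      where
      ψc∥g : ParallelInContr N e (ψ c) g
      ψc∥g = dependent-triple⇒parallel N (ψ-nonloop c) (pair-indep g∉S) ¬ie[ψc]g

    S-extends : ∀ {x} → x ∉ G → Indep N (⁅ x ⁆ ∪ S)
    S-extends {x} x∉G with ψ-covers x (x∉G ∘ ∈G⁺ ∘ inj₁) (pair-indep (x∉G ∘ S⊆G))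
    ... | z , ψz≡x⊎ψz∥x =
      [ (λ ψz≡x → subst (λ y → Indep N (⁅ y ⁆ ∪ S)) ψz≡x iψzS)
      , (λ ψz∥x → parallel-exchange N ψz∥x e∈S (z∉F ∘ C⊆F ∘ ψz∈S⇒z∈C) (x∉G ∘ S⊆G) iψzS)
      ]′ ψz≡x⊎ψz∥x
      where
      z∉F : z ∉ F
      z∉F z∈F = x∉G (∈G⁺ (inj₂ (z , z∈F , Data.Sum.map₂ (proj₂ ∘ proj₂ ∘ proj₂) ψz≡x⊎ψz∥x)))
      iψzS : Indep N (⁅ ψ z ⁆ ∪ S)
      iψzS = to (indep-over-C⇔over-S z) (F-closed z∉F C⊆F iC)

  lifted-closed : Closed N G
  lifted-closed = basis-extends⇒closed N N-dec (S⊆G , iS , S-maximal) S-extends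

lifted-siContrWithin : ∀ {Y K N e} (N-dec : DecIndep N)
                       (σ : IsoSiContr K N e) (ρ : IsoIndRestr Y K) →
                       IsoSiContrWithin Y N e (lifted N N-dec e (proj₁ σ) (proj₁ ρ))
lifted-siContrWithin {N = N} {e} N-dec (ψ , ψ-inj , ψ≢e , ψ-nonloop , _ , ψ-nonparallel , ψ-indep)
                                       (F , _ , χ , χ-inj , χ-range , χ-pres) =
  ψ ∘ χ , χ-inj ∘ ψ-inj , ψχ∈G , ψ≢e ∘ χ , ψ-nonloop ∘ χ , covers ,
  (λ x y x≢y → ψ-nonparallel (χ x) (χ y) (x≢y ∘ χ-inj)) , respectsImage-∘ χ-pres ψ-indep
  where
  G = lifted N N-dec e ψ F
  ψχ∈G : ∀ x → ψ (χ x) ∈ G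
  ψχ∈G x = ∈-lifted⁺ N N-dec e ψ F (inj₂ (χ x , from (χ-range (χ x)) (x , refl) , inj₁ refl))
  covers : ∀ f → f ∈ G → f ≢ e → Indep N (⁅ e ⁆ ∪ ⁅ f ⁆) →
           ∃ λ x → ψ (χ x) ≡ f ⊎ ParallelInContr N e (ψ (χ x)) f
  covers f f∈G f≢e ief with ∈-lifted⁻ N N-dec e ψ F f∈G
  ... | inj₁ f≡e = ⊥-elim (f≢e f≡e)
  ... | inj₂ (z , z∈F , ψz≡f⊎dependent) with to (χ-range z) z∈F
  ...   | x , refl =
    x , Data.Sum.map₂ (dependent-triple⇒parallel N (ψ-nonloop (χ x)) ief) ψz≡f⊎dependent

contraction-restriction-swap :
  ∀ {Y K N e} → Simple N → DecIndep N → DecIndep K → IsoSiContr K N e → IsoIndRestr Y K →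
  Σ[ L ∈ Matroid ] Σ[ e′ ∈ Fin (size L) ] IsoSiContr Y L e′ × IsoIndRestr L N
contraction-restriction-swap {Y} {K} {N} {e} N-simple N-dec K-dec
  σ@(ψ , ψ-inj , ψ≢e , ψ-nonloop , ψ-covers , _ , ψ-indep) ρ@(F , F-flat , _)
  with enumerate (lifted N N-dec e ψ F)
... | k , ι , ι-inj , ι-range with to (ι-range e) (∈-lifted⁺ N N-dec e ψ F (inj₁ refl))
...   | e′ , refl =
  restriction N ι ι-inj , e′ ,
  siContrWithin⇒siContr N ι ι-inj ι-range {Y} (lifted-siContrWithin {Y} {K} {N} N-dec σ ρ) ,
  restriction-indRestr N ι ι-inj ι-range
    (lifted-closed {K} {N} N-simple N-dec ψ-inj ψ≢e ψ-nonloop ψ-covers ψ-indep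
      (flat⇒closed K K-dec F-flat) (proj₂ (proj₂ (extend-to-basis K K-dec ⊥⊆ (indep-∅ K)))))

HasIndRestrIn : Class → Matroid → Set₁
HasIndRestrIn 𝒩 M = ∃ λ Y → 𝒩 Y × IsoIndRestr Y M

LiftsThroughContraction : Class → Set₁
LiftsThroughContraction 𝒩 =
  ∀ M → Simple M → (e : Fin (size M)) → ∀ X → 𝒩 X → IsoSiContr X M e → HasIndRestrIn 𝒩 M

indMinor-reflects-indRestr : ∀ {𝒩} → LiftsThroughContraction 𝒩 →
                             ∀ {K M} → IsoIndMinor K M → Simple M →
                             ¬ HasIndRestrIn 𝒩 M → ¬ HasIndRestrIn 𝒩 K
indMinor-reflects-indRestr lifts {K} {M} (iso θ) _ M-free (Y , Y∈𝒩 , ρ) =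
  ¬¬-decidable (Indep K) λ K-dec → ¬¬-decidable (Indep M) λ M-dec →
  M-free (Y , Y∈𝒩 , indRestr-trans {Y} {K} {M} K-dec M-dec ρ (iso⇒indRestr {K} {M} θ))
indMinor-reflects-indRestr lifts {K} (restrict {K = K′} ρ′ K′≤M) M-simple M-free (Y , Y∈𝒩 , ρ) =
  ¬¬-decidable (Indep K) λ K-dec → ¬¬-decidable (Indep K′) λ K′-dec →
  indMinor-reflects-indRestr lifts K′≤M M-simple M-free
    (Y , Y∈𝒩 , indRestr-trans {Y} {K} {K′} K-dec K′-dec ρ ρ′)
indMinor-reflects-indRestr lifts {K} (contract {K = K′} e σ K′≤M) M-simple M-free (Y , Y∈𝒩 , ρ) =
  simple-indMinor K′≤M M-simple λ K′-simple →
  ¬¬-decidable (Indep K′) λ K′-dec → ¬¬-decidable (Indep K) λ K-dec →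
  let (L , e′ , σ′ , ρ′) =
        contraction-restriction-swap {Y} {K} {K′} {e} K′-simple K′-dec K-dec σ ρ
      (Y′ , Y′∈𝒩 , ρ″)  = lifts L (simple-indRestr {L} {K′} ρ′ K′-simple) e′ Y Y∈𝒩 σ′
  in ¬¬-decidable (Indep L) λ L-dec →
     indMinor-reflects-indRestr lifts K′≤M M-simple M-free
       (Y′ , Y′∈𝒩 , indRestr-trans {Y′} {L} {K′} L-dec K′-dec ρ″ ρ′)

-- A minimal member cannot be chosen constructively, so membership is refuted by induction on size.
no-minimal⇒no-member : ∀ {𝒩 M} → ¬ (∃ λ X → MinimalMembers 𝒩 X × IsoIndMinor X M) →
                       ¬ (∃ λ X → 𝒩 X × IsoIndMinor X M)
no-minimal⇒no-member {𝒩} {M} no-minimal (X , X∈𝒩 , X≤M) = below (suc (size X)) ℕ.≤-refl X∈𝒩 X≤M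
  where
  below : ∀ n {X} → size X < n → 𝒩 X → ¬ IsoIndMinor X M
  below (suc n) {X} (s≤s ∣X∣≤n) X∈𝒩 X≤M = no-minimal (X , (X∈𝒩 , smaller-not-in-𝒩) , X≤M)
    where
    smaller-not-in-𝒩 : ∀ N → ProperIsoIndMinor N X → ¬ 𝒩 N
    smaller-not-in-𝒩 N (N≤X , ∣N∣<∣X∣) N∈𝒩 =
      below n (ℕ.<-≤-trans ∣N∣<∣X∣ ∣X∣≤n) N∈𝒩 (indMinor-trans N≤X X≤M)

indRestr⇒indMinor : ∀ {Y M} → IsoIndRestr Y M → IsoIndMinor Y M
indRestr⇒indMinor {M = M} ρ = restrict {K = M} ρ (iso (Iso-refl M))

lemma3p4 : (𝒩 : Class) → ClassOfSimple 𝒩 → ClosedUnderIso 𝒩 →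
    (∀ M → Simple M → (e : Fin (size M)) → ∀ X → 𝒩 X → IsoSiContr X M e →
       ∃ λ Y → 𝒩 Y × IsoIndRestr Y M) →
    ∀ M → Simple M →
      ((¬ ∃ λ X → MinimalMembers 𝒩 X × IsoIndMinor X M) ⇔
       (¬ ∃ λ Y → 𝒩 Y × IsoIndRestr Y M))
lemma3p4 𝒩 _ _ lifts M M-simple = mk⇔
  (λ no-minimal (Y , Y∈𝒩 , ρ) → no-minimal⇒no-member no-minimal (Y , Y∈𝒩 , indRestr⇒indMinor ρ))
  (λ M-free (X , (X∈𝒩 , _) , X≤M) →
     indMinor-reflects-indRestr lifts X≤M M-simple M-free (X , X∈𝒩 , iso⇒indRestr {X} {X} (Iso-refl X)))
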